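{- Let $s \geq 1$ and $t \geq 2$ be integers and let $\alpha_{s,t}$ be the type-$\alpha$ comb with $s$ teeth of length $t$. Then the number of linear extensions of $\alpha_{s,t}$ that avoid both patterns $213$ and $321$ equals $\binom{s}{2}+1$.
   Context: A linear extension of a finite poset $P$ on a set of integers is a listing $v=[v_1,\dots,v_n]$ of all elements of $P$, each exactly once, such that whenever $a \leq_P b$, $a$ appears before $b$. For $w \in S_3$, a sequence $v$ of distinct integers contains $w$ if there are indices $i<j<k$ with $(v_i,v_j,v_k)$ in the same relative order as $(w_1,w_2,w_3)$; otherwise $v$ avoids $w$. The type-$\alpha$ comb $\alpha_{s,t}$ is the poset on $\{1,\dots,st\}$ whose order is generated by the relations $i \leq i+1$ for $1 \leq i \leq s-1$ (the spine $1,\dots,s$) and $x \leq x+s$ for $1 \leq x \leq (t-1)s$ (so the teeth are $c, c+s, \dots, c+(t-1)s$ for $1\le c\le s$). -}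

module Defs where

open import Data.Nat using (ℕ; zero; suc; _+_; _*_; _∸_; _≤_; _<_)
open import Data.Fin using (Fin; toℕ)
open import Data.List using (List; length; lookup; map; upTo)
open import Data.List.Relation.Binary.Permutation.Propositional using (_↭_)
open import Data.Product using (_×_; ∃-syntax)
open import Relation.Nullary using (¬_)
open import Function.Bundles using (_⇔_)

data Cover (s t : ℕ) : ℕ → ℕ → Set where
  spine : ∀ {i} → 1 ≤ i → i ≤ s ∸ 1 → Cover s t i (suc i)
  tooth : ∀ {x} → 1 ≤ x → x ≤ (t ∸ 1) * s → Cover s t x (x + s)

data _<[α_,_]_ : ℕ → ℕ → ℕ → ℕ → Set where
  base : ∀ {s t a b} → Cover s t a b → a <[α s , t ] b
  step : ∀ {s t a b c} → a <[α s , t ] b → b <[α s , t ] c → a <[α s , t ] c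

elems : ℕ → ℕ → List ℕ
elems s t = map suc (upTo (s * t))

LinExt : ℕ → ℕ → List ℕ → Set
LinExt s t v =
  (v ↭ elems s t) ×
  (∀ (i j : Fin (length v)) → lookup v i <[α s , t ] lookup v j → toℕ i < toℕ j)

SameOrder : ℕ → ℕ → ℕ → ℕ → ℕ → ℕ → Set
SameOrder a b c x y z = ((a < b) ⇔ (x < y)) × ((a < c) ⇔ (x < z)) × ((b < c) ⇔ (y < z))

Contains : ℕ → ℕ → ℕ → List ℕ → Set
Contains w₁ w₂ w₃ v = ∃[ i ] ∃[ j ] ∃[ k ]
  (toℕ i < toℕ j × toℕ j < toℕ k ×
   SameOrder (lookup v i) (lookup v j) (lookup v k) w₁ w₂ w₃)

Avoids : ℕ → ℕ → ℕ → List ℕ → Set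
Avoids w₁ w₂ w₃ v = ¬ Contains w₁ w₂ w₃ v

Good : ℕ → ℕ → List ℕ → Set
Good s t v = LinExt s t v × Avoids 2 1 3 v × Avoids 3 2 1 v

-- A permutation of 1, …, n avoiding 213 and 321 is a rotation
--   1, …, a,  a+b+1, …, a+b+d,  a+1, …, a+b:
-- if its least entry p is not in front, every entry after p lies below the first entry x
-- (else x p y is a 213), every entry between x and p lies above x (else x y p is a 321),
-- and both runs increase.  The only descents of a rotation run from the top block into the
-- middle one, and every element lying below something in α_{s,t} is at most (t-1)s;
-- so for b, d ≥ 1 the rotation is a linear extension when a ≥ (t-1)s, while for a < (t-1)s
-- some tooth x ⋖ x+s leads from the middle block into the top one.  These rotations are
-- indexed by the C(s,2) pairs (a, b) with (t-1)s ≤ a, 1 ≤ b, a + b < st, and the trivial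
-- rotations all equal the identity.

module Submission where

open import Defs
open import Data.Nat using (ℕ; zero; suc; _+_; _*_; _∸_; _≤_; _<_; z≤n; s≤s; _≟_; _≤?_; _<?_)
open import Data.Nat.Properties
open import Data.Nat.Combinatorics using (_C_; nCk+nC[k+1]≡[n+1]C[k+1]; nC1≡n)
open import Data.Fin using (Fin; toℕ) renaming (zero to fzero; suc to fsuc)
open import Data.Fin.Properties using (toℕ-injective)
open import Data.Product using (_×_; _,_; proj₁; proj₂; map₁; ∃-syntax)
open import Data.Sum using (_⊎_; inj₁; inj₂)
open import Data.Empty using (⊥-elim)
open import Data.List using (List; []; _∷_; _++_; [_]; length; lookup; map; applyUpTo)
open import Data.List.Properties using (++-identityʳ; length-++; length-map; map-upTo)
open import Data.List.Membership.Propositional using (_∈_)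
open import Data.List.Membership.Propositional.Properties
  using (∈-++⁺ˡ; ∈-++⁺ʳ; ∈-++⁻; ∈-map⁺; ∈-map⁻; ∈-lookup; ∈-∃++)
open import Data.List.Relation.Unary.Any using (here; there; index)
open import Data.List.Relation.Unary.Any.Properties using (lookup-index)
import Data.List.Relation.Unary.All as All
import Data.List.Relation.Unary.All.Properties as All
open import Data.List.Relation.Unary.AllPairs using ([]; _∷_)
open import Data.List.Relation.Unary.Unique.Propositional using (Unique)
open import Data.List.Relation.Unary.Unique.Propositional.Properties using (map⁺; ++⁺)
open import Data.List.Relation.Binary.Permutation.Propositional
  using (_↭_; ↭-sym; ↭⇒↭ₛ; module PermutationReasoning)
open import Data.List.Relation.Binary.Permutation.Propositional.Properties
  using (↭-empty-inv; ∈-resp-↭; drop-∷; ++⁺ˡ; ++-comm)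
open import Relation.Binary.PropositionalEquality
  using (_≡_; _≢_; refl; sym; trans; cong; cong₂; subst; subst₂; ≢-sym; setoid; module ≡-Reasoning)
open import Data.List.Relation.Binary.Permutation.Setoid.Properties (setoid ℕ) using (Unique-resp-↭)
open import Function using (_∘_)
open import Function.Bundles using (_⇔_; mk⇔; Equivalence)
open import Relation.Binary.Definitions using (tri<; tri≈; tri>)
open import Relation.Nullary using (¬_; yes; no; contradiction)
open import Relation.Nullary.Decidable using (from-yes; from-no)

interval : ℕ → ℕ → List ℕ
interval p zero    = []
interval p (suc k) = p ∷ interval (suc p) k

∈-interval⁻ : ∀ {x} p k → x ∈ interval p k → p ≤ x × x < p + k
∈-interval⁻ p (suc k) (here refl) = ≤-refl , m<m+n p (s≤s z≤n)
∈-interval⁻ {x} p (suc k) (there x∈) with ∈-interval⁻ (suc p) k x∈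
... | p<x , x<p+1+k = <⇒≤ p<x , subst (x <_) (sym (+-suc p k)) x<p+1+k

∈-interval⁺ : ∀ {x} p k → p ≤ x → x < p + k → x ∈ interval p k
∈-interval⁺ {x} p zero    p≤x x<p+0 = ⊥-elim (<⇒≱ (subst (x <_) (+-identityʳ p) x<p+0) p≤x)
∈-interval⁺ {x} p (suc k) p≤x x<p+1+k with x ≟ p
... | yes refl = here refl
... | no  x≢p  = there (∈-interval⁺ (suc p) k (≤∧≢⇒< p≤x (≢-sym x≢p)) (subst (x <_) (+-suc p k) x<p+1+k))

interval-++ : ∀ p a b → interval p a ++ interval (p + a) b ≡ interval p (a + b)
interval-++ p zero    b = cong (λ p′ → interval p′ b) (+-identityʳ p)
interval-++ p (suc a) b = cong (p ∷_) (begin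
  interval (suc p) a ++ interval (p + suc a) b ≡⟨ cong (λ p′ → interval (suc p) a ++ interval p′ b) (+-suc p a) ⟩
  interval (suc p) a ++ interval (suc p + a) b ≡⟨ interval-++ (suc p) a b ⟩
  interval (suc p) (a + b)                     ∎)
  where open ≡-Reasoning

length-interval : ∀ p k → length (interval p k) ≡ k
length-interval p zero    = refl
length-interval p (suc k) = cong suc (length-interval (suc p) k)

interval-unique : ∀ p k → Unique (interval p k)
interval-unique p zero    = []
interval-unique p (suc k) =
  All.tabulate (λ x∈ → <⇒≢ (proj₁ (∈-interval⁻ (suc p) k x∈))) ∷ interval-unique (suc p) k

applyUpTo-interval : ∀ {f} p k → (∀ i → f i ≡ p + i) → applyUpTo f k ≡ interval p k
applyUpTo-interval p zero    f≗p+ = refl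
applyUpTo-interval p (suc k) f≗p+ = cong₂ _∷_ (trans (f≗p+ 0) (+-identityʳ p))
  (applyUpTo-interval (suc p) k (λ i → trans (f≗p+ (suc i)) (+-suc p i)))

module _ {A : Set} where

  data Occurs₂ (y z : A) : List A → Set where
    here₂  : ∀ {v} → z ∈ v → Occurs₂ y z (y ∷ v)
    there₂ : ∀ {u v} → Occurs₂ y z v → Occurs₂ y z (u ∷ v)

  data Occurs₃ (x y z : A) : List A → Set where
    here₃  : ∀ {v} → Occurs₂ y z v → Occurs₃ x y z (x ∷ v)
    there₃ : ∀ {u v} → Occurs₃ x y z v → Occurs₃ x y z (u ∷ v)

  Occurs₂⇒∈ˡ : ∀ {y z v} → Occurs₂ y z v → y ∈ v
  Occurs₂⇒∈ˡ (here₂ _)   = here refl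
  Occurs₂⇒∈ˡ (there₂ yz) = there (Occurs₂⇒∈ˡ yz)

  Occurs₂⇒∈ʳ : ∀ {y z v} → Occurs₂ y z v → z ∈ v
  Occurs₂⇒∈ʳ (here₂ z∈)  = there z∈
  Occurs₂⇒∈ʳ (there₂ yz) = there (Occurs₂⇒∈ʳ yz)

  Occurs₂⇒≢ : ∀ {y z v} → Unique v → Occurs₂ y z v → y ≢ z
  Occurs₂⇒≢ (y∉ ∷ _) (here₂ z∈)  = All.lookup y∉ z∈
  Occurs₂⇒≢ (_ ∷ u)  (there₂ yz) = Occurs₂⇒≢ u yz

  Occurs₂-++⁺ˡ : ∀ {y z P} Q → Occurs₂ y z P → Occurs₂ y z (P ++ Q)
  Occurs₂-++⁺ˡ Q (here₂ z∈)  = here₂ (∈-++⁺ˡ z∈)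
  Occurs₂-++⁺ˡ Q (there₂ yz) = there₂ (Occurs₂-++⁺ˡ Q yz)

  Occurs₂-++⁺ʳ : ∀ {y z Q} P → Occurs₂ y z Q → Occurs₂ y z (P ++ Q)
  Occurs₂-++⁺ʳ []      yz = yz
  Occurs₂-++⁺ʳ (_ ∷ P) yz = there₂ (Occurs₂-++⁺ʳ P yz)

  Occurs₂-++⁺ : ∀ {y z P Q} → y ∈ P → z ∈ Q → Occurs₂ y z (P ++ Q)
  Occurs₂-++⁺ {P = _ ∷ P} (here refl) z∈ = here₂ (∈-++⁺ʳ P z∈)
  Occurs₂-++⁺ {P = _ ∷ P} (there y∈)  z∈ = there₂ (Occurs₂-++⁺ y∈ z∈)

  Occurs₂-++⁻ : ∀ {y z Q} P → Occurs₂ y z (P ++ Q) →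
                Occurs₂ y z P ⊎ (y ∈ P × z ∈ Q) ⊎ Occurs₂ y z Q
  Occurs₂-++⁻ []      yz = inj₂ (inj₂ yz)
  Occurs₂-++⁻ (_ ∷ P) (here₂ z∈) with ∈-++⁻ P z∈
  ... | inj₁ z∈P = inj₁ (here₂ z∈P)
  ... | inj₂ z∈Q = inj₂ (inj₁ (here refl , z∈Q))
  Occurs₂-++⁻ (_ ∷ P) (there₂ yz) with Occurs₂-++⁻ P yz
  ... | inj₁ yz∈P               = inj₁ (there₂ yz∈P)
  ... | inj₂ (inj₁ (y∈P , z∈Q)) = inj₂ (inj₁ (there y∈P , z∈Q))
  ... | inj₂ (inj₂ yz∈Q)        = inj₂ (inj₂ yz∈Q)

  Occurs₃-++⁺ : ∀ {x y z P Q} → Occurs₂ x y P → z ∈ Q → Occurs₃ x y z (P ++ Q)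
  Occurs₃-++⁺ {P = _ ∷ P} (here₂ y∈)  z∈ = here₃ (Occurs₂-++⁺ y∈ z∈)
  Occurs₃-++⁺ {P = _ ∷ P} (there₂ xy) z∈ = there₃ (Occurs₃-++⁺ xy z∈)

  Occurs₂⇒indices : ∀ {y z v} → Occurs₂ y z v →
    ∃[ i ] ∃[ j ] (toℕ i < toℕ j × lookup v i ≡ y × lookup v j ≡ z)
  Occurs₂⇒indices (here₂ z∈) = fzero , fsuc (index z∈) , s≤s z≤n , refl , sym (lookup-index z∈)
  Occurs₂⇒indices (there₂ yz) with Occurs₂⇒indices yz
  ... | i , j , i<j , vi≡y , vj≡z = fsuc i , fsuc j , s≤s i<j , vi≡y , vj≡z

  Occurs₃⇒indices : ∀ {x y z v} → Occurs₃ x y z v →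
    ∃[ i ] ∃[ j ] ∃[ k ] (toℕ i < toℕ j × toℕ j < toℕ k × lookup v i ≡ x × lookup v j ≡ y × lookup v k ≡ z)
  Occurs₃⇒indices (here₃ yz) with Occurs₂⇒indices yz
  ... | j , k , j<k , vj≡y , vk≡z = fzero , fsuc j , fsuc k , s≤s z≤n , s≤s j<k , refl , vj≡y , vk≡z
  Occurs₃⇒indices (there₃ xyz) with Occurs₃⇒indices xyz
  ... | i , j , k , i<j , j<k , vi≡x , vj≡y , vk≡z =
    fsuc i , fsuc j , fsuc k , s≤s i<j , s≤s j<k , vi≡x , vj≡y , vk≡z

  indices⇒Occurs₂ : ∀ v (i j : Fin (length v)) → toℕ i < toℕ j → Occurs₂ (lookup v i) (lookup v j) v
  indices⇒Occurs₂ (_ ∷ v) fzero    (fsuc j) _         = here₂ (∈-lookup j)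
  indices⇒Occurs₂ (_ ∷ v) (fsuc i) (fsuc j) (s≤s i<j) = there₂ (indices⇒Occurs₂ v i j i<j)

Increasing : List ℕ → Set
Increasing u = ∀ {y z} → Occurs₂ y z u → y < z

interval-increasing : ∀ p k → Increasing (interval p k)
interval-increasing p (suc k) (here₂ z∈)  = proj₁ (∈-interval⁻ (suc p) k z∈)
interval-increasing p (suc k) (there₂ yz) = interval-increasing (suc p) k yz

increasing⇒interval : ∀ p k {u} → Increasing u →
  (∀ {y} → y ∈ u → p ≤ y × y < p + k) → (∀ {y} → p ≤ y → y < p + k → y ∈ u) →
  u ≡ interval p k
increasing⇒interval p zero {[]}    _ _      _ = refl
increasing⇒interval p zero {y ∷ u} _ bounds _ with bounds (here refl)
... | p≤y , y<p+0 = ⊥-elim (<⇒≱ (subst (y <_) (+-identityʳ p) y<p+0) p≤y)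
increasing⇒interval p (suc k) {u} increasing bounds complete
  with complete ≤-refl (m<m+n p (s≤s z≤n))
increasing⇒interval p (suc k) {[]}    _          _      _ | ()
increasing⇒interval p (suc k) {y ∷ u} increasing bounds _ | there p∈u =
  ⊥-elim (<⇒≱ (increasing (here₂ p∈u)) (proj₁ (bounds (here refl))))
increasing⇒interval p (suc k) {p ∷ u} increasing bounds complete | here refl =
  cong (p ∷_) (increasing⇒interval (suc p) k (λ yz → increasing (there₂ yz)) bounds′ complete′)
  where
  bounds′ : ∀ {z} → z ∈ u → suc p ≤ z × z < suc p + k
  bounds′ {z} z∈ = increasing (here₂ z∈) , subst (z <_) (+-suc p k) (proj₂ (bounds (there z∈)))

  complete′ : ∀ {z} → suc p ≤ z → z < suc p + k → z ∈ u
  complete′ {z} p<z z< with complete (<⇒≤ p<z) (subst (z <_) (sym (+-suc p k)) z<)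
  ... | here refl = ⊥-elim (<-irrefl refl p<z)
  ... | there z∈u = z∈u

Is213 Is321 : ℕ → ℕ → ℕ → Set
Is213 x y z = y < x × x < z
Is321 x y z = z < y × y < x

Avoids₃ : (ℕ → ℕ → ℕ → Set) → List ℕ → Set
Avoids₃ P v = ∀ {x y z} → Occurs₃ x y z v → ¬ P x y z

module _ {A B : Set} where

  both : A → B → A ⇔ B
  both a b = mk⇔ (λ _ → b) (λ _ → a)

  neither : ¬ A → ¬ B → A ⇔ B
  neither ¬a ¬b = mk⇔ (⊥-elim ∘ ¬a) (⊥-elim ∘ ¬b)

avoids⇒Avoids₃-213 : ∀ {v} → Avoids 2 1 3 v → Avoids₃ Is213 v
avoids⇒Avoids₃-213 avoid xyz (y<x , x<z) with Occurs₃⇒indices xyz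
... | i , j , k , i<j , j<k , refl , refl , refl =
  avoid (i , j , k , i<j , j<k , neither (<⇒≯ y<x) (from-no (2 <? 1)) ,
                                 both x<z (from-yes (2 <? 3)) ,
                                 both (<-trans y<x x<z) (from-yes (1 <? 3)))

avoids⇒Avoids₃-321 : ∀ {v} → Avoids 3 2 1 v → Avoids₃ Is321 v
avoids⇒Avoids₃-321 avoid xyz (z<y , y<x) with Occurs₃⇒indices xyz
... | i , j , k , i<j , j<k , refl , refl , refl =
  avoid (i , j , k , i<j , j<k , neither (<⇒≯ y<x) (from-no (3 <? 2)) ,
                                 neither (<⇒≯ (<-trans z<y y<x)) (from-no (3 <? 1)) ,
                                 neither (<⇒≯ z<y) (from-no (2 <? 1)))

rotation : ℕ → ℕ → ℕ → ℕ → List ℕ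
rotation p a b d = interval p a ++ interval (p + a + b) d ++ interval (p + a) b

module _ {x p hi : ℕ} {w₁ w₂ : List ℕ}
         (unique : Unique (x ∷ w₁ ++ p ∷ w₂))
         (avoid213 : Avoids₃ Is213 (x ∷ w₁ ++ p ∷ w₂)) (avoid321 : Avoids₃ Is321 (x ∷ w₁ ++ p ∷ w₂))
         (bounded : ∀ {y} → y ∈ x ∷ w₁ ++ p ∷ w₂ → p ≤ y × y < hi)
         (complete : ∀ {y} → p ≤ y → y < hi → y ∈ x ∷ w₁ ++ p ∷ w₂) where

  private
    occurs⇒< : ∀ {y z} → Occurs₂ y z (x ∷ w₁ ++ p ∷ w₂) → ¬ z < y → y < z
    occurs⇒< yz z≮y = ≤∧≢⇒< (≮⇒≥ z≮y) (Occurs₂⇒≢ unique yz)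

    occurs⇒> : ∀ {y z} → Occurs₂ y z (x ∷ w₁ ++ p ∷ w₂) → ¬ y < z → z < y
    occurs⇒> yz y≮z = ≤∧≢⇒< (≮⇒≥ y≮z) (≢-sym (Occurs₂⇒≢ unique yz))

    p<x : p < x
    p<x = ≤∧≢⇒< (proj₁ (bounded (here refl))) (≢-sym (Occurs₂⇒≢ unique (here₂ (∈-++⁺ʳ w₁ (here refl)))))

    w₂<x : ∀ {y} → y ∈ w₂ → y < x
    w₂<x y∈ = occurs⇒> (here₂ (∈-++⁺ʳ w₁ (there y∈)))
      λ x<y → avoid213 (here₃ (Occurs₂-++⁺ʳ w₁ (here₂ y∈))) (p<x , x<y)

    p∷w₂<x : ∀ {y} → y ∈ p ∷ w₂ → y < x
    p∷w₂<x (here refl) = p<x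
    p∷w₂<x (there y∈)  = w₂<x y∈

    x<w₁ : ∀ {y} → y ∈ w₁ → x < y
    x<w₁ {y} y∈ = occurs⇒< (here₂ (∈-++⁺ˡ y∈))
      λ y<x → avoid321 (here₃ (Occurs₂-++⁺ y∈ (here refl))) (p<y , y<x)
      where
      p<y : p < y
      p<y = ≤∧≢⇒< (proj₁ (bounded (there (∈-++⁺ˡ y∈))))
                  (≢-sym (Occurs₂⇒≢ unique (there₂ (Occurs₂-++⁺ y∈ (here refl)))))

    x≤x∷w₁ : ∀ {y} → y ∈ x ∷ w₁ → x ≤ y
    x≤x∷w₁ (here refl) = ≤-refl
    x≤x∷w₁ (there y∈)  = <⇒≤ (x<w₁ y∈)

    x∷w₁-increasing : Increasing (x ∷ w₁)
    x∷w₁-increasing yz = occurs⇒< (Occurs₂-++⁺ˡ (p ∷ w₂) yz)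
      λ z<y → avoid321 (Occurs₃-++⁺ yz (here refl)) (<-≤-trans p<x (x≤x∷w₁ (Occurs₂⇒∈ʳ yz)) , z<y)

    p∷w₂-increasing : Increasing (p ∷ w₂)
    p∷w₂-increasing (here₂ z∈) =
      ≤∧≢⇒< (proj₁ (bounded (there (∈-++⁺ʳ w₁ (there z∈)))))
            (Occurs₂⇒≢ unique (there₂ (Occurs₂-++⁺ʳ w₁ (here₂ z∈))))
    p∷w₂-increasing (there₂ yz) = occurs⇒< (there₂ (Occurs₂-++⁺ʳ w₁ (there₂ yz)))
      λ z<y → avoid321 (here₃ (Occurs₂-++⁺ʳ w₁ (there₂ yz))) (z<y , w₂<x (Occurs₂⇒∈ˡ yz))

    x∷w₁≡interval : x ∷ w₁ ≡ interval x (hi ∸ x)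
    x∷w₁≡interval = increasing⇒interval x (hi ∸ x) x∷w₁-increasing
      (λ {y} y∈ → x≤x∷w₁ y∈ , subst (y <_) (sym x+[hi∸x]≡hi) (proj₂ (bounded (∈-++⁺ˡ y∈))))
      (λ {y} x≤y y< → member x≤y (subst (y <_) x+[hi∸x]≡hi y<))
      where
      x+[hi∸x]≡hi : x + (hi ∸ x) ≡ hi
      x+[hi∸x]≡hi = m+[n∸m]≡n (<⇒≤ (proj₂ (bounded (here refl))))

      member : ∀ {y} → x ≤ y → y < hi → y ∈ x ∷ w₁
      member x≤y y<hi with ∈-++⁻ (x ∷ w₁) (complete (≤-trans (<⇒≤ p<x) x≤y) y<hi)
      ... | inj₁ y∈ = y∈
      ... | inj₂ y∈ = ⊥-elim (<⇒≱ (p∷w₂<x y∈) x≤y)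

    p∷w₂≡interval : p ∷ w₂ ≡ interval p (x ∸ p)
    p∷w₂≡interval = increasing⇒interval p (x ∸ p) p∷w₂-increasing
      (λ {y} y∈ → proj₁ (bounded (∈-++⁺ʳ (x ∷ w₁) y∈)) , subst (y <_) (sym p+[x∸p]≡x) (p∷w₂<x y∈))
      (λ {y} p≤y y< → member p≤y (subst (y <_) p+[x∸p]≡x y<))
      where
      p+[x∸p]≡x : p + (x ∸ p) ≡ x
      p+[x∸p]≡x = m+[n∸m]≡n (<⇒≤ p<x)

      member : ∀ {y} → p ≤ y → y < x → y ∈ p ∷ w₂
      member p≤y y<x with ∈-++⁻ (x ∷ w₁) (complete p≤y (<-trans y<x (proj₂ (bounded (here refl)))))
      ... | inj₁ y∈ = ⊥-elim (<⇒≱ y<x (x≤x∷w₁ y∈))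
      ... | inj₂ y∈ = y∈

  split-at-minimum⇒rotation : x ∷ w₁ ++ p ∷ w₂ ≡ rotation p 0 (x ∸ p) (hi ∸ x)
  split-at-minimum⇒rotation = begin
    (x ∷ w₁) ++ p ∷ w₂                        ≡⟨ cong₂ _++_ x∷w₁≡interval p∷w₂≡interval ⟩
    interval x (hi ∸ x) ++ interval p (x ∸ p) ≡⟨ cong₂ (λ m m′ → interval m (hi ∸ x) ++ interval m′ (x ∸ p))
                                                       (sym p+0+[x∸p]≡x) (sym (+-identityʳ p)) ⟩
    rotation p 0 (x ∸ p) (hi ∸ x)             ∎
    where
    open ≡-Reasoning
    p+0+[x∸p]≡x : p + 0 + (x ∸ p) ≡ x
    p+0+[x∸p]≡x = trans (cong (_+ (x ∸ p)) (+-identityʳ p)) (m+[n∸m]≡n (<⇒≤ p<x))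

rotation-suc : ∀ p a b d → p ∷ rotation (suc p) a b d ≡ rotation p (suc a) b d
rotation-suc p a b d =
  cong (λ m → p ∷ interval (suc p) a ++ interval (m + b) d ++ interval m b) (sym (+-suc p a))

avoiding⇒rotation : ∀ p k {v} → v ↭ interval p k → Avoids₃ Is213 v → Avoids₃ Is321 v →
  ∃[ a ] ∃[ b ] ∃[ d ] (a + b + d ≡ k × v ≡ rotation p a b d)
avoiding⇒rotation p zero v↭[] _ _ with ↭-empty-inv v↭[]
... | refl = 0 , 0 , 0 , refl , refl
avoiding⇒rotation p (suc k) v↭ avoid213 avoid321 with ∈-∃++ (∈-resp-↭ (↭-sym v↭) (here refl))
... | [] , w₂ , refl
  with avoiding⇒rotation (suc p) k (drop-∷ v↭) (λ xyz → avoid213 (there₃ xyz)) (λ xyz → avoid321 (there₃ xyz))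
...   | a , b , d , a+b+d≡k , refl = suc a , b , d , cong suc a+b+d≡k , rotation-suc p a b d
avoiding⇒rotation p (suc k) v↭ avoid213 avoid321 | x ∷ w₁ , w₂ , refl =
  0 , x ∸ p , p + suc k ∸ x , sum , split-at-minimum⇒rotation unique avoid213 avoid321 bounded complete
  where
  unique : Unique (x ∷ w₁ ++ p ∷ w₂)
  unique = Unique-resp-↭ (↭⇒↭ₛ (↭-sym v↭)) (interval-unique p (suc k))

  bounded : ∀ {y} → y ∈ x ∷ w₁ ++ p ∷ w₂ → p ≤ y × y < p + suc k
  bounded y∈ = ∈-interval⁻ p (suc k) (∈-resp-↭ v↭ y∈)

  complete : ∀ {y} → p ≤ y → y < p + suc k → y ∈ x ∷ w₁ ++ p ∷ w₂
  complete p≤y y< = ∈-resp-↭ (↭-sym v↭) (∈-interval⁺ p (suc k) p≤y y<)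

  sum : 0 + (x ∸ p) + (p + suc k ∸ x) ≡ suc k
  sum = +-cancelˡ-≡ p _ _ (begin
    p + ((x ∸ p) + (p + suc k ∸ x)) ≡⟨ sym (+-assoc p (x ∸ p) _) ⟩
    p + (x ∸ p) + (p + suc k ∸ x)   ≡⟨ cong (_+ (p + suc k ∸ x)) (m+[n∸m]≡n (proj₁ (bounded (here refl)))) ⟩
    x + (p + suc k ∸ x)             ≡⟨ m+[n∸m]≡n (<⇒≤ (proj₂ (bounded (here refl)))) ⟩
    p + suc k                       ∎)
    where open ≡-Reasoning

rotation-Occurs₂ : ∀ p a b d {y z} → Occurs₂ y z (rotation p a b d) →
  y < z ⊎ (p + a + b ≤ y × p + a ≤ z × z < p + a + b)
rotation-Occurs₂ p a b d yz with Occurs₂-++⁻ (interval p a) yz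
... | inj₁ yz∈P = inj₁ (interval-increasing p a yz∈P)
... | inj₂ (inj₁ (y∈P , z∈HL)) = inj₁ (<-≤-trans (proj₂ (∈-interval⁻ p a y∈P)) (p+a≤ z∈HL))
  where
  p+a≤ : ∀ {z} → z ∈ interval (p + a + b) d ++ interval (p + a) b → p + a ≤ z
  p+a≤ z∈ with ∈-++⁻ (interval (p + a + b) d) z∈
  ... | inj₁ z∈H = ≤-trans (m≤m+n (p + a) b) (proj₁ (∈-interval⁻ _ d z∈H))
  ... | inj₂ z∈L = proj₁ (∈-interval⁻ _ b z∈L)
... | inj₂ (inj₂ yz∈HL) with Occurs₂-++⁻ (interval (p + a + b) d) yz∈HL
...   | inj₁ yz∈H                = inj₁ (interval-increasing _ d yz∈H)
...   | inj₂ (inj₁ (y∈H , z∈L)) = inj₂ (proj₁ (∈-interval⁻ _ d y∈H) , ∈-interval⁻ _ b z∈L)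
...   | inj₂ (inj₂ yz∈L)        = inj₁ (interval-increasing _ b yz∈L)

rotation-Occurs₂-low : ∀ p a b d {y z} → Occurs₂ y z (rotation p a b d) →
  p + a ≤ y → y < p + a + b → z < p + a + b
rotation-Occurs₂-low p a b d yz p+a≤y y<p+a+b with Occurs₂-++⁻ (interval p a) yz
... | inj₁ yz∈P           = ⊥-elim (<⇒≱ (proj₂ (∈-interval⁻ p a (Occurs₂⇒∈ˡ yz∈P))) p+a≤y)
... | inj₂ (inj₁ (y∈P , _)) = ⊥-elim (<⇒≱ (proj₂ (∈-interval⁻ p a y∈P)) p+a≤y)
... | inj₂ (inj₂ yz∈HL) with Occurs₂-++⁻ (interval (p + a + b) d) yz∈HL
...   | inj₁ yz∈H           = ⊥-elim (<⇒≱ y<p+a+b (proj₁ (∈-interval⁻ _ d (Occurs₂⇒∈ˡ yz∈H))))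
...   | inj₂ (inj₁ (y∈H , _)) = ⊥-elim (<⇒≱ y<p+a+b (proj₁ (∈-interval⁻ _ d y∈H)))
...   | inj₂ (inj₂ yz∈L)    = proj₂ (∈-interval⁻ _ b (Occurs₂⇒∈ʳ yz∈L))

rotation-avoids-213 : ∀ p a b d → Avoids 2 1 3 (rotation p a b d)
rotation-avoids-213 p a b d (i , j , k , i<j , j<k , x<y⇔2<1 , x<z⇔2<3 , _)
  with rotation-Occurs₂ p a b d (indices⇒Occurs₂ (rotation p a b d) i j i<j)
... | inj₁ x<y = from-no (2 <? 1) (Equivalence.to x<y⇔2<1 x<y)
... | inj₂ (p+a+b≤x , p+a≤y , y<p+a+b) = <-irrefl refl (<-≤-trans (<-trans x<z z<p+a+b) p+a+b≤x)
  where
  x<z = Equivalence.from x<z⇔2<3 (from-yes (2 <? 3))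
  z<p+a+b = rotation-Occurs₂-low p a b d (indices⇒Occurs₂ (rotation p a b d) j k j<k) p+a≤y y<p+a+b

rotation-avoids-321 : ∀ p a b d → Avoids 3 2 1 (rotation p a b d)
rotation-avoids-321 p a b d (i , j , k , i<j , j<k , x<y⇔3<2 , _ , y<z⇔2<1)
  with rotation-Occurs₂ p a b d (indices⇒Occurs₂ (rotation p a b d) i j i<j)
     | rotation-Occurs₂ p a b d (indices⇒Occurs₂ (rotation p a b d) j k j<k)
... | inj₁ x<y | _ = from-no (3 <? 2) (Equivalence.to x<y⇔3<2 x<y)
... | _ | inj₁ y<z = from-no (2 <? 1) (Equivalence.to y<z⇔2<1 y<z)
... | inj₂ (_ , _ , y<p+a+b) | inj₂ (p+a+b≤y , _) = <⇒≱ y<p+a+b p+a+b≤y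

rotation-↭ : ∀ p a b d → rotation p a b d ↭ interval p (a + b + d)
rotation-↭ p a b d = begin
  interval p a ++ interval (p + a + b) d ++ interval (p + a) b ↭⟨ ++⁺ˡ (interval p a) (++-comm (interval (p + a + b) d) _) ⟩
  interval p a ++ interval (p + a) b ++ interval (p + a + b) d ≡⟨ cong (interval p a ++_) (interval-++ (p + a) b d) ⟩
  interval p a ++ interval (p + a) (b + d)                     ≡⟨ interval-++ p a (b + d) ⟩
  interval p (a + (b + d))                                     ≡⟨ cong (interval p) (sym (+-assoc a b d)) ⟩
  interval p (a + b + d)                                       ∎
  where open PermutationReasoning

rotation-trivial : ∀ p a b d → b ≡ 0 ⊎ d ≡ 0 → rotation p a b d ≡ interval p (a + b + d)
rotation-trivial p a .0 d (inj₁ refl) = begin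
  interval p a ++ interval (p + a + 0) d ++ [] ≡⟨ cong (λ m → interval p a ++ m) (++-identityʳ _) ⟩
  interval p a ++ interval (p + a + 0) d      ≡⟨ cong (λ m → interval p a ++ interval m d) (+-identityʳ (p + a)) ⟩
  interval p a ++ interval (p + a) d          ≡⟨ interval-++ p a d ⟩
  interval p (a + d)                          ≡⟨ cong (λ m → interval p (m + d)) (sym (+-identityʳ a)) ⟩
  interval p (a + 0 + d)                      ∎
  where open ≡-Reasoning
rotation-trivial p a b .0 (inj₂ refl) =
  trans (interval-++ p a b) (cong (interval p) (sym (+-identityʳ (a + b))))

<α⇒< : ∀ {s t a b} → 1 ≤ s → a <[α s , t ] b → a < b
<α⇒< _   (base (spine _ _))     = ≤-refl
<α⇒< 1≤s (base (tooth {x} _ _)) = m<m+n x 1≤s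
<α⇒< 1≤s (step a<b b<c)         = <-trans (<α⇒< 1≤s a<b) (<α⇒< 1≤s b<c)

<α⇒≤[t∸1]*s : ∀ {s t a b} → 2 ≤ t → a <[α s , t ] b → a ≤ (t ∸ 1) * s
<α⇒≤[t∸1]*s {s} (s≤s (s≤s {n = t′} _)) (base (spine _ i≤s∸1)) =
  ≤-trans i≤s∸1 (≤-trans (m∸n≤m s 1) (m≤m+n s (t′ * s)))
<α⇒≤[t∸1]*s _   (base (tooth _ x≤[t∸1]*s)) = x≤[t∸1]*s
<α⇒≤[t∸1]*s 2≤t (step a<b _)               = <α⇒≤[t∸1]*s 2≤t a<b

elems≡interval : ∀ s t → elems s t ≡ interval 1 (s * t)
elems≡interval s t = trans (map-upTo suc (s * t)) (applyUpTo-interval 1 (s * t) (λ _ → refl))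

-- x ⋖ x + s is a tooth edge from the block a+1, …, a+b into the block above it
tooth-crossing : ∀ {s q a b} → 1 ≤ s → a < q → 1 ≤ b → a + b < q + s →
  ∃[ x ] (a < x × x ≤ a + b × a + b < x + s × x ≤ q)
tooth-crossing {s} {q} {a} {b} 1≤s a<q 1≤b a+b<q+s with ≤-total b s
... | inj₁ b≤s = suc a , ≤-refl , m<m+n a 1≤b , s≤s (+-monoʳ-≤ a b≤s) , a<q
... | inj₂ s≤b with m≤n⇒∃[o]m+o≡n s≤b
...   | e , refl =
  suc (a + e) , s≤s (m≤m+n a e) , subst (suc (a + e) ≤_) (sym a+[s+e]≡a+e+s) (m<m+n (a + e) 1≤s) ,
  s≤s (≤-reflexive a+[s+e]≡a+e+s) ,
  +-cancelʳ-≤ s (suc (a + e)) q (subst (λ m → suc m ≤ q + s) a+[s+e]≡a+e+s a+b<q+s)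
  where
  a+[s+e]≡a+e+s : a + (s + e) ≡ a + e + s
  a+[s+e]≡a+e+s = trans (cong (a +_) (+-comm s e)) (sym (+-assoc a e s))

pairs : ℕ → ℕ → List (ℕ × ℕ)
pairs a zero    = []
pairs a (suc r) = map (a ,_) (interval 1 r) ++ pairs (suc a) r

∈-pairs⁻ : ∀ a r {x y} → (x , y) ∈ pairs a r → a ≤ x × 1 ≤ y × x + y < a + r
∈-pairs⁻ a (suc r) xy∈ with ∈-++⁻ (map (a ,_) (interval 1 r)) xy∈
... | inj₁ xy∈map with ∈-map⁻ (a ,_) xy∈map
...   | y , y∈ , refl = ≤-refl , proj₁ (∈-interval⁻ 1 r y∈) , +-monoʳ-< a (proj₂ (∈-interval⁻ 1 r y∈))
∈-pairs⁻ a (suc r) {x} {y} xy∈ | inj₂ xy∈pairs with ∈-pairs⁻ (suc a) r xy∈pairs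
... | a<x , 1≤y , x+y< = <⇒≤ a<x , 1≤y , subst (x + y <_) (sym (+-suc a r)) x+y<

∈-pairs⁺ : ∀ a r {x y} → a ≤ x → 1 ≤ y → x + y < a + r → (x , y) ∈ pairs a r
∈-pairs⁺ a zero {x} {y} a≤x _ x+y<a+0 =
  ⊥-elim (<⇒≱ (subst (x + y <_) (+-identityʳ a) x+y<a+0) (≤-trans a≤x (m≤m+n x y)))
∈-pairs⁺ a (suc r) {x} {y} a≤x 1≤y x+y< with x ≟ a
... | yes refl = ∈-++⁺ˡ (∈-map⁺ (a ,_) (∈-interval⁺ 1 r 1≤y (+-cancelˡ-< a y (suc r) x+y<)))
... | no  x≢a  = ∈-++⁺ʳ (map (a ,_) (interval 1 r))
  (∈-pairs⁺ (suc a) r (≤∧≢⇒< a≤x (≢-sym x≢a)) 1≤y (subst (x + y <_) (+-suc a r) x+y<))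

pairs-unique : ∀ a r → Unique (pairs a r)
pairs-unique a zero    = []
pairs-unique a (suc r) = ++⁺ (map⁺ (cong proj₂) (interval-unique 1 r)) (pairs-unique (suc a) r) disjoint
  where
  disjoint : ∀ {xy} → ¬ (xy ∈ map (a ,_) (interval 1 r) × xy ∈ pairs (suc a) r)
  disjoint (xy∈map , xy∈pairs) with ∈-map⁻ (a ,_) xy∈map
  ... | _ , _ , refl = <-irrefl refl (proj₁ (∈-pairs⁻ (suc a) r xy∈pairs))

length-pairs : ∀ a r → length (pairs a r) ≡ r C 2
length-pairs a zero    = refl
length-pairs a (suc r) = begin
  length (map (a ,_) (interval 1 r) ++ pairs (suc a) r)         ≡⟨ length-++ (map (a ,_) (interval 1 r)) ⟩
  length (map (a ,_) (interval 1 r)) + length (pairs (suc a) r) ≡⟨ cong₂ _+_ length-first-column (length-pairs (suc a) r) ⟩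
  r + r C 2                                                     ≡⟨ cong (_+ r C 2) (sym (nC1≡n r)) ⟩
  r C 1 + r C 2                                                 ≡⟨ nCk+nC[k+1]≡[n+1]C[k+1] r 1 ⟩
  suc r C 2                                                     ∎
  where
  open ≡-Reasoning
  length-first-column : length (map (a ,_) (interval 1 r)) ≡ r
  length-first-column = trans (length-map (a ,_) (interval 1 r)) (length-interval 1 r)

Unique-map⁺ : ∀ {A B : Set} {f : A → B} (g : B → A) {xs} →
  (∀ {x} → x ∈ xs → g (f x) ≡ x) → Unique xs → Unique (map f xs)
Unique-map⁺ g retract [] = []
Unique-map⁺ g retract (x∉xs ∷ unique) =
  All.map⁺ (All.tabulate λ y∈ fx≡fy →
    All.lookup x∉xs y∈ (trans (sym (retract (here refl))) (trans (cong g fx≡fy) (retract (there y∈)))))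
  ∷ Unique-map⁺ g (λ x∈ → retract (there x∈)) unique

prefixRun : ℕ → List ℕ → ℕ × ℕ
prefixRun k []      = 0 , 0
prefixRun k (x ∷ v) with x ≟ k
... | yes _ = map₁ suc (prefixRun (suc k) v)
... | no  _ = 0 , x ∸ k

prefixRun-interval : ∀ k a v → prefixRun k (interval k a ++ v) ≡ map₁ (a +_) (prefixRun (k + a) v)
prefixRun-interval k zero    v = cong (λ m → prefixRun m v) (sym (+-identityʳ k))
prefixRun-interval k (suc a) v with k ≟ k
... | no  k≢k = contradiction refl k≢k
... | yes _   = trans (cong (map₁ suc) (prefixRun-interval (suc k) a v))
                      (cong (λ m → map₁ (suc a +_) (prefixRun m v)) (sym (+-suc k a)))

prefixRun-mismatch : ∀ {k x} v → x ≢ k → prefixRun k (x ∷ v) ≡ (0 , x ∸ k)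
prefixRun-mismatch {k} {x} v x≢k with x ≟ k
... | yes x≡k = contradiction x≡k x≢k
... | no  _   = refl

prefixRun-rotation : ∀ a b d → 1 ≤ b → 1 ≤ d → prefixRun 1 (rotation 1 a b d) ≡ (a , b)
prefixRun-rotation a zero    _       ()
prefixRun-rotation a (suc b) zero    _ ()
prefixRun-rotation a (suc b) (suc d) _ _ = begin
  prefixRun 1 (rotation 1 a (suc b) (suc d))                  ≡⟨ prefixRun-interval 1 a _ ⟩
  map₁ (a +_) (prefixRun (suc a) (interval (suc a + suc b) (suc d) ++ interval (suc a) (suc b)))
    ≡⟨ cong (map₁ (a +_)) (prefixRun-mismatch _ (≢-sym (<⇒≢ (m<m+n (suc a) (s≤s z≤n))))) ⟩
  (a + 0 , suc a + suc b ∸ suc a)                             ≡⟨ cong₂ _,_ (+-identityʳ a) (m+n∸m≡n (suc a) (suc b)) ⟩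
  (a , suc b)                                                 ∎
  where open ≡-Reasoning

module CombExtensions (s t : ℕ) (1≤s : 1 ≤ s) (2≤t : 2 ≤ t) where

  n q : ℕ
  n = s * t
  q = (t ∸ 1) * s

  q+s≡n : q + s ≡ n
  q+s≡n = begin
    (t ∸ 1) * s + s     ≡⟨ cong ((t ∸ 1) * s +_) (sym (*-identityˡ s)) ⟩
    (t ∸ 1) * s + 1 * s ≡⟨ sym (*-distribʳ-+ s (t ∸ 1) 1) ⟩
    (t ∸ 1 + 1) * s     ≡⟨ cong (_* s) (m∸n+n≡m (≤-trans (s≤s z≤n) 2≤t)) ⟩
    t * s               ≡⟨ *-comm t s ⟩
    s * t               ∎
    where open ≡-Reasoning

  rotation-linearExtension : ∀ {a b d} → q ≤ a → a + b + d ≡ n → LinExt s t (rotation 1 a b d)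
  rotation-linearExtension {a} {b} {d} q≤a a+b+d≡n = permutation , respects
    where
    v : List ℕ
    v = rotation 1 a b d

    permutation : v ↭ elems s t
    permutation =
      subst (v ↭_) (trans (cong (interval 1) a+b+d≡n) (sym (elems≡interval s t))) (rotation-↭ 1 a b d)

    respects : ∀ i j → lookup v i <[α s , t ] lookup v j → toℕ i < toℕ j
    respects i j vi<vj with <-cmp (toℕ i) (toℕ j)
    ... | tri< i<j _ _ = i<j
    ... | tri≈ _ i≡j _ = ⊥-elim (<-irrefl (cong (lookup v) (toℕ-injective i≡j)) (<α⇒< 1≤s vi<vj))
    ... | tri> _ _ j<i with rotation-Occurs₂ 1 a b d (indices⇒Occurs₂ v j i j<i)
    ...   | inj₁ vj<vi            = ⊥-elim (<-asym vj<vi (<α⇒< 1≤s vi<vj))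
    ...   | inj₂ (_ , a<vi , _) = ⊥-elim (<⇒≱ a<vi (≤-trans (<α⇒≤[t∸1]*s 2≤t vi<vj) q≤a))

  rotation-good : ∀ {a b d} → q ≤ a → a + b + d ≡ n → Good s t (rotation 1 a b d)
  rotation-good {a} {b} {d} q≤a a+b+d≡n =
    rotation-linearExtension q≤a a+b+d≡n , rotation-avoids-213 1 a b d , rotation-avoids-321 1 a b d

  private
    a+b<q+s : ∀ {a b d} → 1 ≤ d → a + b + d ≡ n → a + b < q + s
    a+b<q+s {a} {b} 1≤d a+b+d≡n = subst (a + b <_) (trans a+b+d≡n (sym q+s≡n)) (m<m+n (a + b) 1≤d)

    upper-before-lower : ∀ {a b d x} → a + b + d ≡ n → a < x → x ≤ a + b → a + b < x + s → x ≤ q →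
      Occurs₂ (x + s) x (rotation 1 a b d)
    upper-before-lower {a} {b} {d} {x} a+b+d≡n a<x x≤a+b a+b<x+s x≤q = Occurs₂-++⁺ʳ (interval 1 a)
      (Occurs₂-++⁺ (∈-interval⁺ (suc (a + b)) d a+b<x+s
                     (s≤s (subst (x + s ≤_) (trans q+s≡n (sym a+b+d≡n)) (+-monoˡ-≤ s x≤q))))
                   (∈-interval⁺ (suc a) b a<x (s≤s x≤a+b)))

  linearExtension⇒q≤a : ∀ {a b d} → 1 ≤ b → 1 ≤ d → a + b + d ≡ n → LinExt s t (rotation 1 a b d) → q ≤ a
  linearExtension⇒q≤a {a} {b} {d} 1≤b 1≤d a+b+d≡n (_ , respects) with q ≤? a
  ... | yes q≤a = q≤a
  ... | no  q≰a with tooth-crossing 1≤s (≰⇒> q≰a) 1≤b (a+b<q+s {a} {b} 1≤d a+b+d≡n)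
  ...   | x , a<x , x≤a+b , a+b<x+s , x≤q with Occurs₂⇒indices (upper-before-lower a+b+d≡n a<x x≤a+b a+b<x+s x≤q)
  ...     | i , j , i<j , vi≡x+s , vj≡x = ⊥-elim (<-asym i<j (respects j i
    (subst₂ _<[α s , t ]_ (sym vj≡x) (sym vi≡x+s) (base (tooth (≤-trans (s≤s z≤n) a<x) x≤q)))))

  good⇒rotation : ∀ {v} → Good s t v → ∃[ a ] ∃[ b ] ∃[ d ] (a + b + d ≡ n × v ≡ rotation 1 a b d)
  good⇒rotation {v} ((v↭elems , _) , avoid213 , avoid321) =
    avoiding⇒rotation 1 n (subst (v ↭_) (elems≡interval s t) v↭elems)
      (avoids⇒Avoids₃-213 avoid213) (avoids⇒Avoids₃-321 avoid321)

  rotationOf : ℕ × ℕ → List ℕ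
  rotationOf (a , b) = rotation 1 a b (n ∸ (a + b))

  extensions : List (List ℕ)
  extensions = map rotationOf (pairs q s) ++ [ interval 1 n ]

  private
    pair⇒bounds : ∀ {a b} → (a , b) ∈ pairs q s → q ≤ a × 1 ≤ b × a + b < n
    pair⇒bounds {a} {b} ab∈ with ∈-pairs⁻ q s ab∈
    ... | q≤a , 1≤b , a+b<q+s = q≤a , 1≤b , subst (a + b <_) q+s≡n a+b<q+s

    prefixRun-rotationOf : ∀ {a b} → (a , b) ∈ pairs q s → prefixRun 1 (rotationOf (a , b)) ≡ (a , b)
    prefixRun-rotationOf {a} {b} ab∈ with pair⇒bounds ab∈
    ... | _ , 1≤b , a+b<n = prefixRun-rotation a b (n ∸ (a + b)) 1≤b (m+n≤o⇒m≤o∸n 1 a+b<n)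

  extensions-unique : Unique extensions
  extensions-unique =
    ++⁺ (Unique-map⁺ (prefixRun 1) prefixRun-rotationOf (pairs-unique q s)) (All.[] ∷ []) disjoint
    where
    identity-run : proj₂ (prefixRun 1 (interval 1 n)) ≡ 0
    identity-run =
      cong proj₂ (trans (cong (prefixRun 1) (sym (++-identityʳ (interval 1 n)))) (prefixRun-interval 1 n []))

    disjoint : ∀ {v} → ¬ (v ∈ map rotationOf (pairs q s) × v ∈ [ interval 1 n ])
    disjoint (v∈map , here refl) with ∈-map⁻ rotationOf v∈map
    ... | (a , b) , ab∈ , v≡ with pair⇒bounds ab∈
    ...   | _ , 1≤b , _ = <⇒≢ 1≤b (sym (begin
      b                                           ≡⟨ cong proj₂ (prefixRun-rotationOf ab∈) ⟨
      proj₂ (prefixRun 1 (rotationOf (a , b)))   ≡⟨ cong (proj₂ ∘ prefixRun 1) v≡ ⟨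
      proj₂ (prefixRun 1 (interval 1 n))         ≡⟨ identity-run ⟩
      0                                           ∎))
      where open ≡-Reasoning

  extension⇒good : ∀ {v} → v ∈ extensions → Good s t v
  extension⇒good v∈ with ∈-++⁻ (map rotationOf (pairs q s)) v∈
  ... | inj₁ v∈map with ∈-map⁻ rotationOf v∈map
  ...   | (a , b) , ab∈ , refl with pair⇒bounds ab∈
  ...     | q≤a , _ , a+b<n = rotation-good q≤a (m+[n∸m]≡n (<⇒≤ a+b<n))
  extension⇒good v∈ | inj₂ (here refl) =
    subst (Good s t) (++-identityʳ (interval 1 n))
      (rotation-good (subst (q ≤_) q+s≡n (m≤m+n q s)) (trans (+-identityʳ (n + 0)) (+-identityʳ n)))

  private
    trivial-rotation∈extensions : ∀ a b d → b ≡ 0 ⊎ d ≡ 0 → a + b + d ≡ n → rotation 1 a b d ∈ extensions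
    trivial-rotation∈extensions a b d b≡0⊎d≡0 a+b+d≡n = ∈-++⁺ʳ (map rotationOf (pairs q s))
      (here (trans (rotation-trivial 1 a b d b≡0⊎d≡0) (cong (interval 1) a+b+d≡n)))

  good⇒extension : ∀ {v} → Good s t v → v ∈ extensions
  good⇒extension good@(linExt , _) with good⇒rotation good
  ... | a , zero  , d     , a+b+d≡n , refl = trivial-rotation∈extensions a 0 d (inj₁ refl) a+b+d≡n
  ... | a , suc b , zero  , a+b+d≡n , refl = trivial-rotation∈extensions a (suc b) 0 (inj₂ refl) a+b+d≡n
  ... | a , suc b , suc d , a+b+d≡n , refl =
    subst (_∈ extensions) (cong (rotation 1 a (suc b)) n∸[a+b]≡d)
      (∈-++⁺ˡ (∈-map⁺ rotationOf (∈-pairs⁺ q s q≤a (s≤s z≤n) (a+b<q+s {a} {suc b} (s≤s z≤n) a+b+d≡n))))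
    where
    q≤a : q ≤ a
    q≤a = linearExtension⇒q≤a (s≤s z≤n) (s≤s z≤n) a+b+d≡n linExt

    n∸[a+b]≡d : n ∸ (a + suc b) ≡ suc d
    n∸[a+b]≡d = trans (cong (_∸ (a + suc b)) (sym a+b+d≡n)) (m+n∸m≡n (a + suc b) (suc d))

  length-extensions : length extensions ≡ s C 2 + 1
  length-extensions = begin
    length (map rotationOf (pairs q s) ++ [ interval 1 n ]) ≡⟨ length-++ (map rotationOf (pairs q s)) ⟩
    length (map rotationOf (pairs q s)) + 1                 ≡⟨ cong (_+ 1) (length-map rotationOf (pairs q s)) ⟩
    length (pairs q s) + 1                                  ≡⟨ cong (_+ 1) (length-pairs q s) ⟩
    s C 2 + 1                                               ∎
    where open ≡-Reasoning

theorem13 : (s t : ℕ) → 1 ≤ s → 2 ≤ t →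
    ∃[ L ] (Unique L × (∀ (v : List ℕ) → (v ∈ L) ⇔ Good s t v) × length L ≡ (s C 2) + 1)
theorem13 s t 1≤s 2≤t =
  extensions , extensions-unique , (λ v → mk⇔ extension⇒good good⇒extension) , length-extensions
  where open CombExtensions s t 1≤s 2≤t
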